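{- Let $h\in[m]$, $n\ge 1$ and $D = (h, \dots, h) \in [m]^n$. Then $p_*(D) = p_{\textsc{Bins}(h)}(D)$.
   Context: Fix $m\in\mathbb N$ and the universe of IDs $[m]=\{1,\dots,m\}$. An ID-generation algorithm $\mathcal A$ is a probability distribution over permutations of $[m]$: an instance draws a permutation and answers its $t$-th request with the $t$-th entry. A demand profile $D=(d_1,\dots,d_n)$ means $n$ instances of $\mathcal A$ with independent randomness, instance $i$ receiving $d_i$ requests. A collision occurs if the sets of output IDs are not pairwise disjoint; $p_{\mathcal A}(D)$ is the collision probability and $p_*(D)=\min_{\mathcal A'}p_{\mathcal A'}(D)$ over all algorithms. $\textsc{Bins}(k)$: partition $[m]$ into $\lfloor m/k\rfloor$ bins of $k$ IDs and $m\bmod k$ leftover IDs; pick a uniformly random permutation of the bins, return all IDs of each shuffled bin in increasing order before moving to the next, then the leftover IDs in increasing order.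
   Formalization: In $p_*(D)$ the minimum ranges only over algorithms whose probability distributions on permutations of $[m]$ have rational weights. -}

module Defs where

open import Data.Nat as ℕ using (ℕ; zero; suc; NonZero; _≡ᵇ_)
open import Data.Nat.DivMod using (_/_)
open import Data.Integer using (+_)
open import Data.Rational as ℚ using (ℚ; 0ℚ; 1ℚ; _≤_)
open import Data.Bool using (Bool; true; false; not; _∧_; if_then_else_)
open import Data.List using (List; []; _∷_; [_]; map; concatMap; take; foldr; length; upTo; applyUpTo; replicate; _++_)
open import Data.Bool.ListAction using (all; any)
open import Data.List.Relation.Unary.All using (All)
open import Data.List.Relation.Binary.Permutation.Propositional using (_↭_)
open import Data.Product using (_×_; _,_; proj₁; proj₂)
open import Relation.Binary.PropositionalEquality using (_≡_)

universe : ℕ → List ℕ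
universe m = applyUpTo suc m

IsPerm : ℕ → List ℕ → Set
IsPerm m π = π ↭ universe m

-- An ID-generation algorithm: a (finitely supported, which is automatic since there
-- are finitely many permutations) probability distribution over permutations of [m],
-- given as a list of (weight , permutation) pairs.
record Algorithm (m : ℕ) : Set where
  field
    support    : List (ℚ × List ℕ)
    nonneg     : All (λ wp → 0ℚ ≤ proj₁ wp) support
    total      : foldr (λ wp s → proj₁ wp ℚ.+ s) 0ℚ support ≡ 1ℚ
    arePerms   : All (λ wp → IsPerm m (proj₂ wp)) support

-- sets given as duplicate-free lists; disjointness and pairwise disjointness
disjoint : List ℕ → List ℕ → Bool
disjoint s t = not (any (λ x → any (λ y → x ≡ᵇ y) t) s)

pairwiseDisjoint : List (List ℕ) → Bool
pairwiseDisjoint [] = true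
pairwiseDisjoint (s ∷ ss) = all (disjoint s) ss ∧ pairwiseDisjoint ss

sumℚ : List ℚ → ℚ
sumℚ = foldr ℚ._+_ 0ℚ

-- Collision probability for a weighted list of permutations (independent draws,
-- one per instance), demand profile D, with already-produced output sets acc.
collProbAux : List (ℚ × List ℕ) → List ℕ → List (List ℕ) → ℚ
collProbAux A [] acc = if pairwiseDisjoint acc then 0ℚ else 1ℚ
collProbAux A (d ∷ ds) acc =
  sumℚ (map (λ wp → proj₁ wp ℚ.* collProbAux A ds (take d (proj₂ wp) ∷ acc)) A)

collProbList : List (ℚ × List ℕ) → List ℕ → ℚ
collProbList A D = collProbAux A D []

collProb : {m : ℕ} → Algorithm m → List ℕ → ℚ
collProb A D = collProbList (Algorithm.support A) D

insertAll : {A : Set} → A → List A → List (List A)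
insertAll x [] = [ x ∷ [] ]
insertAll x (y ∷ ys) = (x ∷ y ∷ ys) ∷ map (y ∷_) (insertAll x ys)

perms : {A : Set} → List A → List (List A)
perms [] = [ [] ]
perms (x ∷ xs) = concatMap (insertAll x) (perms xs)

uniformWeight : ℕ → ℚ
uniformWeight zero = 0ℚ
uniformWeight (suc n) = + 1 ℚ./ suc n

-- Bins(k): bin j (0 ≤ j < ⌊m/k⌋) = IDs j*k+1 , … , j*k+k ; leftovers = ⌊m/k⌋*k+1 , … , m
bin : ℕ → ℕ → List ℕ
bin k j = applyUpTo (λ r → suc (j ℕ.* k ℕ.+ r)) k

binsOutput : (m k : ℕ) .{{_ : NonZero k}} → List ℕ → List ℕ
binsOutput m k σ = concatMap (bin k) σ ++ applyUpTo (λ r → suc ((m / k) ℕ.* k ℕ.+ r)) (m ℕ.∸ (m / k) ℕ.* k)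

binsSupport : (m k : ℕ) .{{_ : NonZero k}} → List (ℚ × List ℕ)
binsSupport m k = map (λ σ → uniformWeight (length bs) , binsOutput m k σ) bs
  where bs = perms (upTo (m / k))

collProbBins : (m k : ℕ) .{{_ : NonZero k}} → List ℕ → ℚ
collProbBins m k D = collProbList (binsSupport m k) D

-- An instance serving h requests only uses the first h IDs of its permutation, so an
-- algorithm amounts to a weighted family of h-sets of IDs, and p_A(D) = 1 - G where G is
-- the total weight of the n-tuples of pairwise disjoint sets. G is affine in the weights
-- of any two overlapping sets (a collision-free tuple uses at most one of them, at most
-- once), so moving all weight onto the better of the two does not decrease G. Repeating
-- this leaves pairwise disjoint sets, at most b = ⌊m/h⌋ of them, and then
-- G = n! e_n(weights) ≤ n! e_n(1/b, …, 1/b) by Maclaurin's inequality. The right-hand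
-- side is G for Bins(h), whose first bin is uniformly distributed among the b bins.

module Submission where

-- Wrapped in a module because it opens ℚ's _≤_, while the statement of lemma5p2 uses ℕ's.
module BinsOptimality where

  open import Defs
  open import Data.Bool using (Bool; true; false; not; _∧_; T)
  open import Data.Bool.Properties using (T-≡)
  open import Data.Bool.ListAction using (all; any)
  open import Data.Empty using (⊥-elim)
  open import Data.List using (List; []; _∷_; map; concatMap; concat; take; length; _++_; replicate; applyUpTo; upTo)
  import Data.List.Properties as List
  open import Data.List.Membership.Propositional using (_∈_; find; lose)
  open import Data.List.Membership.Propositional.Properties using (∈-++⁺ˡ; ∈-++⁺ʳ; ∈-++⁻; ∈-map⁻; ∈-concat⁻′; ∈-applyUpTo⁻; ∈-∃++)
  open import Data.List.Relation.Binary.Disjoint.Propositional using (Disjoint)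
  import Data.List.Relation.Binary.Disjoint.Propositional.Properties as Disjoint
  open import Data.List.Relation.Binary.Permutation.Propositional using (_↭_; ↭⇒↭ₛ; ↭-refl; ↭-reflexive; ↭-prep; ↭-swap; ↭-trans; ↭-sym)
  import Data.List.Relation.Binary.Permutation.Propositional as Perm
  import Data.List.Relation.Binary.Permutation.Propositional.Properties as ↭
  open import Data.List.Relation.Binary.Permutation.Setoid.Properties using (foldr-commMonoid; Unique-resp-↭)
  open import Data.List.Relation.Unary.All using (All; []; _∷_; tabulate)
  import Data.List.Relation.Unary.All as All
  import Data.List.Relation.Unary.All.Properties as All
  open import Data.List.Relation.Unary.AllPairs using (AllPairs; []; _∷_)
  import Data.List.Relation.Unary.AllPairs as AllPairs
  import Data.List.Relation.Unary.AllPairs.Properties as AllPairs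
  open import Data.List.Relation.Unary.Unique.Propositional using (Unique)
  import Data.List.Relation.Unary.Unique.Propositional.Properties as Unique
  open import Data.List.Relation.Unary.Any using (here; there)
  open import Data.List.Relation.Unary.Any.Properties using (any⁺; any⁻)
  open import Data.Nat as ℕ using (ℕ; zero; suc; _≡ᵇ_)
  import Data.Integer as ℤ
  import Data.Integer.Properties as ℤ
  import Data.Sign as Sign
  import Data.Nat.Properties as ℕ
  open import Data.Nat.DivMod using (_/_; m*n/n≡m; m<n⇒m/n≡0; m≥n⇒m/n>0; m/n*n≤m; /-monoˡ-≤; +-distrib-/-∣ˡ)
  open import Data.Nat.Divisibility using (n∣m*n)
  open import Data.Product using (_×_; _,_; proj₁; proj₂; ∃; ∃₂)
  open import Data.Rational as ℚ using (ℚ; 0ℚ; 1ℚ; _+_; _*_; _-_; -_; _≤_)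
  open import Data.Rational.Literals using (fromℤ)
  import Data.Rational.Properties as ℚ
  open import Data.Sum using (_⊎_; inj₁; inj₂)
  open import Function using (_∘_; _⇔_; mk⇔; Equivalence)
  open import Level using (0ℓ)
  open import Relation.Binary.PropositionalEquality
  open import Relation.Nullary.Decidable using (dec⇒maybe)
  open import Relation.Nullary.Negation using (contradiction)
  open import Tactic.RingSolver using (solve-∀)
  open import Tactic.RingSolver.Core.AlmostCommutativeRing using (AlmostCommutativeRing; fromCommutativeRing)

  ℚ-ring : AlmostCommutativeRing 0ℓ 0ℓ
  ℚ-ring = fromCommutativeRing ℚ.+-*-commutativeRing (λ x → dec⇒maybe (0ℚ ℚ.≟ x))

  private
    variable
      A B : Set

  sumMap : (A → ℚ) → List A → ℚ
  sumMap f xs = sumℚ (map f xs)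

  sumMap-cong : ∀ {f g : A → ℚ} xs → (∀ {x} → x ∈ xs → f x ≡ g x) → sumMap f xs ≡ sumMap g xs
  sumMap-cong []       f≗g = refl
  sumMap-cong (x ∷ xs) f≗g = cong₂ _+_ (f≗g (here refl)) (sumMap-cong xs (f≗g ∘ there))

  sumMap-+ : ∀ (f g : A → ℚ) xs → sumMap (λ x → f x + g x) xs ≡ sumMap f xs + sumMap g xs
  sumMap-+ f g []       = refl
  sumMap-+ f g (x ∷ xs) = trans (cong ((f x + g x) +_) (sumMap-+ f g xs)) (lemma (f x) (g x) _ _)
    where
    lemma : ∀ a b c d → (a + b) + (c + d) ≡ (a + c) + (b + d)
    lemma = solve-∀ ℚ-ring

  sumMap-*ˡ : ∀ c (f : A → ℚ) xs → sumMap (λ x → c * f x) xs ≡ c * sumMap f xs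
  sumMap-*ˡ c f []       = sym (ℚ.*-zeroʳ c)
  sumMap-*ˡ c f (x ∷ xs) = trans (cong (c * f x +_) (sumMap-*ˡ c f xs)) (sym (ℚ.*-distribˡ-+ c (f x) _))

  sumMap-++ : ∀ (f : A → ℚ) xs ys → sumMap f (xs ++ ys) ≡ sumMap f xs + sumMap f ys
  sumMap-++ f []       ys = sym (ℚ.+-identityˡ _)
  sumMap-++ f (x ∷ xs) ys = trans (cong (f x +_) (sumMap-++ f xs ys)) (sym (ℚ.+-assoc (f x) _ _))

  sumMap-↭ : ∀ (f : A → ℚ) {xs ys} → xs ↭ ys → sumMap f xs ≡ sumMap f ys
  sumMap-↭ f p = foldr-commMonoid (setoid ℚ) ℚ.+-0-isCommutativeMonoid (↭⇒↭ₛ (↭.map⁺ f p))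

  sumMap-map : ∀ (f : B → ℚ) (g : A → B) xs → sumMap f (map g xs) ≡ sumMap (f ∘ g) xs
  sumMap-map f g xs = cong sumℚ (sym (List.map-∘ xs))

  sumMap-concatMap : ∀ (f : B → ℚ) (g : A → List B) xs →
    sumMap f (concatMap g xs) ≡ sumMap (sumMap f ∘ g) xs
  sumMap-concatMap f g []       = refl
  sumMap-concatMap f g (x ∷ xs) =
    trans (sumMap-++ f (g x) (concatMap g xs)) (cong (sumMap f (g x) +_) (sumMap-concatMap f g xs))

  fromℕ : ℕ → ℚ
  fromℕ zero    = 0ℚ
  fromℕ (suc k) = 1ℚ + fromℕ k

  fromℕ≡fromℤ : ∀ k → fromℕ k ≡ fromℤ (ℤ.+ k)
  fromℕ≡fromℤ zero    = refl
  fromℕ≡fromℤ (suc k) = begin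
    1ℚ + fromℕ k         ≡⟨ cong (1ℚ +_) (fromℕ≡fromℤ k) ⟩
    1ℚ + fromℤ (ℤ.+ k)   ≡⟨ ℚ./-cong {p₁ = ℤ.1ℤ ℤ.+ (Sign.+ ℤ.◃ (k ℕ.* 1))} numerator refl ⟩
    ℤ.+ suc k ℚ./ 1      ≡⟨ ℚ.↥p/↧p≡p (fromℤ (ℤ.+ suc k)) ⟩
    fromℤ (ℤ.+ suc k)    ∎
    where
    open ≡-Reasoning
    -- 1ℚ + fromℤ (ℤ.+ k) unfolds to a fraction over 1 * 1 with this numerator.
    numerator : ℤ.1ℤ ℤ.+ (Sign.+ ℤ.◃ (k ℕ.* 1)) ≡ ℤ.+ suc k
    numerator rewrite ℕ.*-identityʳ k | ℤ.+◃n≡+n k = refl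

  fromℕ*uniformWeight : ∀ k .{{_ : ℕ.NonZero k}} → fromℕ k * uniformWeight k ≡ 1ℚ
  fromℕ*uniformWeight (suc k) = begin
    fromℕ (suc k) * uniformWeight (suc k)        ≡⟨ cong₂ _*_ (fromℕ≡fromℤ (suc k)) (ℚ.↥p/↧p≡p (ℚ.1/ fromℤ (ℤ.+ suc k))) ⟩
    fromℤ (ℤ.+ suc k) * ℚ.1/ fromℤ (ℤ.+ suc k)  ≡⟨ ℚ.*-inverseʳ (fromℤ (ℤ.+ suc k)) ⟩
    1ℚ                                           ∎
    where open ≡-Reasoning

  infixr 8 _^_

  _^_ : ℚ → ℕ → ℚ
  x ^ zero  = 1ℚ
  x ^ suc n = x * x ^ n

  𝟙 : Bool → ℚ
  𝟙 true  = 1ℚ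
  𝟙 false = 0ℚ

  𝟙-∧ : ∀ a b → 𝟙 (a ∧ b) ≡ 𝟙 a * 𝟙 b
  𝟙-∧ true  b = sym (ℚ.*-identityˡ (𝟙 b))
  𝟙-∧ false b = sym (ℚ.*-zeroˡ (𝟙 b))

  0≤1 : 0ℚ ≤ 1ℚ
  0≤1 = ℚ.<⇒≤ (ℚ.positive⁻¹ 1ℚ)

  0≤+ : ∀ {a b} → 0ℚ ≤ a → 0ℚ ≤ b → 0ℚ ≤ a + b
  0≤+ = ℚ.+-mono-≤

  0≤* : ∀ {a b} → 0ℚ ≤ a → 0ℚ ≤ b → 0ℚ ≤ a * b
  0≤* {a} {b} 0≤a 0≤b = ℚ.nonNegative⁻¹ (a * b) {{ℚ.nonNeg*nonNeg⇒nonNeg a {{ℚ.nonNegative 0≤a}} b {{ℚ.nonNegative 0≤b}}}}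

  *-monoˡ-≤-0≤ : ∀ {c a b} → 0ℚ ≤ c → a ≤ b → c * a ≤ c * b
  *-monoˡ-≤-0≤ {c} 0≤c = ℚ.*-monoˡ-≤-nonNeg c {{ℚ.nonNegative 0≤c}}

  0≤fromℕ : ∀ k → 0ℚ ≤ fromℕ k
  0≤fromℕ zero    = ℚ.≤-refl
  0≤fromℕ (suc k) = 0≤+ 0≤1 (0≤fromℕ k)

  Overlap : List ℕ → List ℕ → Set
  Overlap xs ys = ∃ λ x → x ∈ xs × x ∈ ys

  overlap-sym : ∀ {xs ys} → Overlap xs ys → Overlap ys xs
  overlap-sym (x , x∈xs , x∈ys) = x , x∈ys , x∈xs

  private
    T-any-any⇔Overlap : ∀ {xs ys} → T (any (λ x → any (λ y → x ≡ᵇ y) ys) xs) ⇔ Overlap xs ys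
    T-any-any⇔Overlap {xs} {ys} = mk⇔ to from
      where
      to : T (any (λ x → any (λ y → x ≡ᵇ y) ys) xs) → Overlap xs ys
      to h with x , x∈xs , hx ← find (any⁻ _ xs h) with y , y∈ys , x≡ᵇy ← find (any⁻ _ ys hx) =
        x , x∈xs , subst (_∈ ys) (sym (ℕ.≡ᵇ⇒≡ x y x≡ᵇy)) y∈ys
      from : Overlap xs ys → T (any (λ x → any (λ y → x ≡ᵇ y) ys) xs)
      from (x , x∈xs , x∈ys) = any⁺ _ (lose x∈xs (any⁺ _ (lose x∈ys (ℕ.≡⇒≡ᵇ x x refl))))

  Overlap⇒disjoint-false : ∀ {xs ys} → Overlap xs ys → disjoint xs ys ≡ false
  Overlap⇒disjoint-false o = cong not (Equivalence.to T-≡ (Equivalence.from T-any-any⇔Overlap o))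

  disjoint-false⇒Overlap : ∀ {xs ys} → disjoint xs ys ≡ false → Overlap xs ys
  disjoint-false⇒Overlap {xs} {ys} d with any (λ x → any (λ y → x ≡ᵇ y) ys) xs in eq
  ... | true = Equivalence.to T-any-any⇔Overlap (Equivalence.from T-≡ eq)

  disjoint-true⇒Disjoint : ∀ {xs ys} → disjoint xs ys ≡ true → Disjoint xs ys
  disjoint-true⇒Disjoint d o with () ← trans (sym d) (Overlap⇒disjoint-false (_ , o))

  Disjoint⇒disjoint-true : ∀ {xs ys} → Disjoint xs ys → disjoint xs ys ≡ true
  Disjoint⇒disjoint-true {xs} {ys} dj with disjoint xs ys in eq
  ... | true  = refl
  ... | false = ⊥-elim (dj (proj₂ (disjoint-false⇒Overlap eq)))

  disjoint-cong : ∀ {xs ys xs′ ys′} → Overlap xs ys ⇔ Overlap xs′ ys′ → disjoint xs ys ≡ disjoint xs′ ys′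
  disjoint-cong {xs} {ys} {xs′} {ys′} o⇔o′ with disjoint xs ys in eq | disjoint xs′ ys′ in eq′
  ... | true  | true  = refl
  ... | false | false = refl
  ... | true  | false = ⊥-elim (disjoint-true⇒Disjoint eq (proj₂ (Equivalence.from o⇔o′ (disjoint-false⇒Overlap eq′))))
  ... | false | true  = ⊥-elim (disjoint-true⇒Disjoint eq′ (proj₂ (Equivalence.to o⇔o′ (disjoint-false⇒Overlap eq))))

  disjoint-comm : ∀ xs ys → disjoint xs ys ≡ disjoint ys xs
  disjoint-comm xs ys = disjoint-cong {xs} {ys} (mk⇔ overlap-sym overlap-sym)

  disjoint-[]ʳ : ∀ xs → disjoint xs [] ≡ true
  disjoint-[]ʳ xs = Disjoint⇒disjoint-true {xs} {[]} (λ ())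

  disjoint-++ʳ : ∀ xs ys zs → disjoint xs (ys ++ zs) ≡ disjoint xs ys ∧ disjoint xs zs
  disjoint-++ʳ xs ys zs with disjoint xs ys in eq
  ... | false with x , x∈xs , x∈ys ← disjoint-false⇒Overlap {xs} {ys} eq =
    Overlap⇒disjoint-false {xs} (x , x∈xs , ∈-++⁺ˡ x∈ys)
  ... | true  = disjoint-cong {xs} {ys ++ zs} (mk⇔ to (λ (x , x∈xs , x∈zs) → x , x∈xs , ∈-++⁺ʳ ys x∈zs))
    where
    to : Overlap xs (ys ++ zs) → Overlap xs zs
    to (x , x∈xs , x∈ys++zs) with ∈-++⁻ ys x∈ys++zs
    ... | inj₁ x∈ys = ⊥-elim (disjoint-true⇒Disjoint {xs} eq (x∈xs , x∈ys))
    ... | inj₂ x∈zs = x , x∈xs , x∈zs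

  𝟙-disjoint-++ʳ : ∀ xs ys zs → 𝟙 (disjoint xs (ys ++ zs)) ≡ 𝟙 (disjoint xs ys) * 𝟙 (disjoint xs zs)
  𝟙-disjoint-++ʳ xs ys zs = trans (cong 𝟙 (disjoint-++ʳ xs ys zs)) (𝟙-∧ (disjoint xs ys) (disjoint xs zs))

  disjoint-resp-↭ : ∀ xs {ys zs} → ys ↭ zs → disjoint xs ys ≡ disjoint xs zs
  disjoint-resp-↭ xs {ys} {zs} p = disjoint-cong {xs} {ys} (mk⇔
    (λ (x , x∈xs , x∈ys) → x , x∈xs , ↭.∈-resp-↭ p x∈ys)
    (λ (x , x∈xs , x∈zs) → x , x∈xs , ↭.∈-resp-↭ (↭-sym p) x∈zs))

  -- The no-collision weight

  WeightedSet : Set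
  WeightedSet = ℚ × List ℕ

  -- The probability that n independent draws from L have pairwise disjoint sets, all
  -- disjoint from the reserved IDs U.
  noCollision : ℕ → List WeightedSet → List ℕ → ℚ
  reserving   : ℕ → List WeightedSet → List ℕ → List ℕ → ℚ

  noCollision zero    L U = 1ℚ
  noCollision (suc n) L U = sumMap (λ (w , S) → w * reserving n L S U) L

  reserving n L S U = 𝟙 (disjoint S U) * noCollision n L (S ++ U)

  noCollision-resp-↭ʳ : ∀ n L {U U′} → U ↭ U′ → noCollision n L U ≡ noCollision n L U′
  noCollision-resp-↭ʳ zero    L p = refl
  noCollision-resp-↭ʳ (suc n) L p = sumMap-cong L λ {(w , S)} _ →
    cong₂ (λ b g → w * (𝟙 b * g)) (disjoint-resp-↭ S p) (noCollision-resp-↭ʳ n L (↭.++⁺ˡ S p))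

  noCollision-resp-↭ˡ : ∀ n {L L′} U → L ↭ L′ → noCollision n L U ≡ noCollision n L′ U
  noCollision-resp-↭ˡ zero    U p = refl
  noCollision-resp-↭ˡ (suc n) {L} U p = trans
    (sumMap-cong L λ {(w , S)} _ → cong (λ g → w * (𝟙 (disjoint S U) * g)) (noCollision-resp-↭ˡ n (S ++ U) p))
    (sumMap-↭ _ p)

  noCollision-blocked : ∀ n w S L U → Overlap S U → noCollision n ((w , S) ∷ L) U ≡ noCollision n L U
  noCollision-blocked zero    w S L U o = refl
  noCollision-blocked (suc n) w S L U o = begin
    w * (𝟙 (disjoint S U) * g) + sumMap (λ (w′ , S′) → w′ * reserving n L′ S′ U) L
      ≡⟨ cong₂ (λ b x → w * (𝟙 b * g) + x) (Overlap⇒disjoint-false {S} o) (sumMap-cong L λ {(w′ , S′)} _ →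
           cong (λ g → w′ * (𝟙 (disjoint S′ U) * g)) (noCollision-blocked n w S L (S′ ++ U) (widen S′ o))) ⟩
    w * (0ℚ * g) + noCollision (suc n) L U
      ≡⟨ zero-summand w g _ ⟩
    noCollision (suc n) L U ∎
    where
    open ≡-Reasoning
    L′ = (w , S) ∷ L
    g = noCollision n L′ (S ++ U)
    widen : ∀ S′ → Overlap S U → Overlap S (S′ ++ U)
    widen S′ (x , x∈S , x∈U) = x , x∈S , ∈-++⁺ʳ S′ x∈U
    zero-summand : ∀ w x y → w * (0ℚ * x) + y ≡ y
    zero-summand = solve-∀ ℚ-ring

  reserving-comm : ∀ n L S S′ U →
    𝟙 (disjoint S′ U) * reserving n L S (S′ ++ U) ≡ 𝟙 (disjoint S U) * reserving n L S′ (S ++ U)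
  reserving-comm n L S S′ U = begin
    𝟙 (disjoint S′ U) * (𝟙 (disjoint S (S′ ++ U)) * noCollision n L (S ++ (S′ ++ U)))
      ≡⟨ cong₂ (λ i g′ → 𝟙 (disjoint S′ U) * (i * g′)) (𝟙-disjoint-++ʳ S S′ U) (noCollision-resp-↭ʳ n L (↭.shifts S S′)) ⟩
    𝟙 (disjoint S′ U) * ((𝟙 (disjoint S S′) * 𝟙 (disjoint S U)) * g)
      ≡⟨ cong (λ b → 𝟙 (disjoint S′ U) * ((𝟙 b * 𝟙 (disjoint S U)) * g)) (disjoint-comm S S′) ⟩
    𝟙 (disjoint S′ U) * ((𝟙 (disjoint S′ S) * 𝟙 (disjoint S U)) * g)
      ≡⟨ rearrange (𝟙 (disjoint S′ U)) (𝟙 (disjoint S′ S)) (𝟙 (disjoint S U)) g ⟩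
    𝟙 (disjoint S U) * ((𝟙 (disjoint S′ S) * 𝟙 (disjoint S′ U)) * g)
      ≡⟨ cong (λ i → 𝟙 (disjoint S U) * (i * g)) (𝟙-disjoint-++ʳ S′ S U) ⟨
    𝟙 (disjoint S U) * (𝟙 (disjoint S′ (S ++ U)) * g) ∎
    where
    open ≡-Reasoning
    g = noCollision n L (S′ ++ (S ++ U))
    rearrange : ∀ a b c g → a * ((b * c) * g) ≡ c * ((b * a) * g)
    rearrange = solve-∀ ℚ-ring

  reserving-suc : ∀ n L S U →
    reserving (suc n) L S U ≡ sumMap (λ (w′ , S′) → w′ * (𝟙 (disjoint S′ U) * reserving n L S (S′ ++ U))) L
  reserving-suc n L S U = sym (begin
    sumMap (λ (w′ , S′) → w′ * (𝟙 (disjoint S′ U) * reserving n L S (S′ ++ U))) L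
      ≡⟨ sumMap-cong L (λ {(w′ , S′)} _ → trans (cong (w′ *_) (reserving-comm n L S S′ U)) (swap w′ (𝟙 (disjoint S U)) (reserving n L S′ (S ++ U)))) ⟩
    sumMap (λ (w′ , S′) → 𝟙 (disjoint S U) * (w′ * reserving n L S′ (S ++ U))) L
      ≡⟨ sumMap-*ˡ (𝟙 (disjoint S U)) _ L ⟩
    reserving (suc n) L S U ∎)
    where
    open ≡-Reasoning
    swap : ∀ a b c → a * (b * c) ≡ b * (a * c)
    swap = solve-∀ ℚ-ring

  -- Since S overlaps itself, a collision-free sequence draws the new entry (w , S) at most
  -- once; there are suc n positions for it.
  noCollision-∷ : ∀ n w S L U → ∃ (_∈ S) →
    noCollision (suc n) ((w , S) ∷ L) U ≡ noCollision (suc n) L U + fromℕ (suc n) * (w * reserving n L S U)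
  noCollision-∷ zero w S L U _ = lemma w (reserving 0 L S U) (noCollision 1 L U)
    where
    lemma : ∀ w r g → w * r + g ≡ g + (1ℚ + 0ℚ) * (w * r)
    lemma = solve-∀ ℚ-ring
  noCollision-∷ (suc n) w S L U (x , x∈S) = begin
    w * reserving (suc n) L′ S U + sumMap (λ (w′ , S′) → w′ * reserving (suc n) L′ S′ U) L
      ≡⟨ cong₂ _+_ (cong (λ g → w * (𝟙 (disjoint S U) * g)) (noCollision-blocked (suc n) w S L (S ++ U) (_ , x∈S , ∈-++⁺ˡ x∈S)))
                   (sumMap-cong L λ {(w′ , S′)} _ → cong (λ g → w′ * (𝟙 (disjoint S′ U) * g)) (noCollision-∷ n w S L (S′ ++ U) (x , x∈S))) ⟩
    w * R + sumMap (λ (w′ , S′) → w′ * (𝟙 (disjoint S′ U) * (noCollision (suc n) L (S′ ++ U) + k * (w * reserving n L S (S′ ++ U))))) L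
      ≡⟨ cong (w * R +_) (sumMap-cong L λ {(w′ , S′)} _ → distribute w′ (𝟙 (disjoint S′ U)) _ k w _) ⟩
    w * R + sumMap (λ (w′ , S′) → w′ * reserving (suc n) L S′ U + (k * w) * (w′ * (𝟙 (disjoint S′ U) * reserving n L S (S′ ++ U)))) L
      ≡⟨ cong (w * R +_) (trans (sumMap-+ _ _ L) (cong (noCollision (suc (suc n)) L U +_) (sumMap-*ˡ (k * w) _ L))) ⟩
    w * R + (noCollision (suc (suc n)) L U + (k * w) * sumMap (λ (w′ , S′) → w′ * (𝟙 (disjoint S′ U) * reserving n L S (S′ ++ U))) L)
      ≡⟨ cong (λ r → w * R + (noCollision (suc (suc n)) L U + (k * w) * r)) (reserving-suc n L S U) ⟨
    w * R + (noCollision (suc (suc n)) L U + (k * w) * R)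
      ≡⟨ collect w R (noCollision (suc (suc n)) L U) k ⟩
    noCollision (suc (suc n)) L U + fromℕ (suc (suc n)) * (w * R) ∎
    where
    open ≡-Reasoning
    L′ = (w , S) ∷ L
    k = fromℕ (suc n)
    R = reserving (suc n) L S U
    distribute : ∀ w′ i g k w r → w′ * (i * (g + k * (w * r))) ≡ w′ * (i * g) + (k * w) * (w′ * (i * r))
    distribute = solve-∀ ℚ-ring
    collect : ∀ w R g k → w * R + (g + (k * w) * R) ≡ g + (1ℚ + k) * (w * R)
    collect = solve-∀ ℚ-ring

  -- n! times the n-th elementary symmetric polynomial
  elemSym : ℕ → List ℚ → ℚ
  elemSym zero    xs       = 1ℚ
  elemSym (suc n) []       = 0ℚ
  elemSym (suc n) (x ∷ xs) = elemSym (suc n) xs + fromℕ (suc n) * (x * elemSym n xs)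

  Clique : List WeightedSet → Set
  Clique = AllPairs (λ (_ , S) (_ , S′) → Disjoint S S′)

  Disjoint-++ʳ : ∀ {xs ys zs : List ℕ} → Disjoint xs ys → Disjoint xs zs → Disjoint xs (ys ++ zs)
  Disjoint-++ʳ {ys = ys} xs#ys xs#zs (v∈xs , v∈ys++zs) with ∈-++⁻ ys v∈ys++zs
  ... | inj₁ v∈ys = xs#ys (v∈xs , v∈ys)
  ... | inj₂ v∈zs = xs#zs (v∈xs , v∈zs)

  noCollision-clique : ∀ n L U → Clique L → All (λ (_ , S) → Disjoint S U × ∃ (_∈ S)) L →
    noCollision n L U ≡ elemSym n (map proj₁ L)
  noCollision-clique zero    L             U _ _ = refl
  noCollision-clique (suc n) []            U _ _ = refl
  noCollision-clique (suc n) ((w , S) ∷ L) U (S#L ∷ clique) ((S#U , x∈S) ∷ L-ok) = begin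
    noCollision (suc n) ((w , S) ∷ L) U
      ≡⟨ noCollision-∷ n w S L U x∈S ⟩
    noCollision (suc n) L U + fromℕ (suc n) * (w * (𝟙 (disjoint S U) * noCollision n L (S ++ U)))
      ≡⟨ cong₂ (λ g i → g + fromℕ (suc n) * (w * (𝟙 i * noCollision n L (S ++ U))))
               (noCollision-clique (suc n) L U clique L-ok) (Disjoint⇒disjoint-true {S} S#U) ⟩
    elemSym (suc n) ws + fromℕ (suc n) * (w * (1ℚ * noCollision n L (S ++ U)))
      ≡⟨ cong (λ g → elemSym (suc n) ws + fromℕ (suc n) * (w * g))
              (trans (ℚ.*-identityˡ _) (noCollision-clique n L (S ++ U) clique (reserve S#L L-ok))) ⟩
    elemSym (suc n) (w ∷ ws) ∎
    where
    open ≡-Reasoning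
    ws = map proj₁ L
    reserve : ∀ {L} → All (λ (_ , S′) → Disjoint S S′) L → All (λ (_ , S′) → Disjoint S′ U × ∃ (_∈ S′)) L →
              All (λ (_ , S′) → Disjoint S′ (S ++ U) × ∃ (_∈ S′)) L
    reserve []                []                   = []
    reserve (S#S′ ∷ S#L) ((S′#U , x∈S′) ∷ L-ok) =
      ((λ {v} → Disjoint-++ʳ (Disjoint.sym {A = ℕ} S#S′) S′#U {v}) , x∈S′) ∷ reserve S#L L-ok

  -- Merging overlapping sets

  noCollision-overlapping-pair : ∀ n a b S₁ S₂ R U → Overlap S₁ S₂ →
    noCollision (suc n) ((a , S₁) ∷ (b , S₂) ∷ R) U
      ≡ noCollision (suc n) R U + fromℕ (suc n) * (a * reserving n R S₁ U + b * reserving n R S₂ U)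
  noCollision-overlapping-pair n a b S₁ S₂ R U (x , x∈S₁ , x∈S₂) = begin
    noCollision (suc n) ((a , S₁) ∷ (b , S₂) ∷ R) U
      ≡⟨ noCollision-∷ n a S₁ ((b , S₂) ∷ R) U (x , x∈S₁) ⟩
    noCollision (suc n) ((b , S₂) ∷ R) U + k * (a * (𝟙 (disjoint S₁ U) * noCollision n ((b , S₂) ∷ R) (S₁ ++ U)))
      ≡⟨ cong₂ (λ g g₁ → g + k * (a * (𝟙 (disjoint S₁ U) * g₁)))
               (noCollision-∷ n b S₂ R U (x , x∈S₂)) (noCollision-blocked n b S₂ R (S₁ ++ U) (x , x∈S₂ , ∈-++⁺ˡ x∈S₁)) ⟩
    (noCollision (suc n) R U + k * (b * reserving n R S₂ U)) + k * (a * reserving n R S₁ U)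
      ≡⟨ regroup (noCollision (suc n) R U) k a b (reserving n R S₁ U) (reserving n R S₂ U) ⟩
    noCollision (suc n) R U + k * (a * reserving n R S₁ U + b * reserving n R S₂ U) ∎
    where
    open ≡-Reasoning
    k = fromℕ (suc n)
    regroup : ∀ g k a b r₁ r₂ → (g + k * (b * r₂)) + k * (a * r₁) ≡ g + k * (a * r₁ + b * r₂)
    regroup = solve-∀ ℚ-ring

  -- The weight is affine in the weight of each of two overlapping entries, so moving all
  -- of it onto the better one cannot decrease it.
  noCollision-merge : ∀ {P : List ℕ → Set} n a b S₁ S₂ R U → 0ℚ ≤ a → 0ℚ ≤ b → Overlap S₁ S₂ → P S₁ → P S₂ →
    ∃ λ S → P S × noCollision n ((a , S₁) ∷ (b , S₂) ∷ R) U ≤ noCollision n ((a + b , S) ∷ R) U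
  noCollision-merge zero a b S₁ S₂ R U _ _ _ p₁ _ = S₁ , p₁ , ℚ.≤-refl
  noCollision-merge {P} (suc n) a b S₁ S₂ R U 0≤a 0≤b o@(x , x∈S₁ , x∈S₂) p₁ p₂ = choose (ℚ.≤-total r₂ r₁)
    where
    r₁ = reserving n R S₁ U
    r₂ = reserving n R S₂ U
    merged-≤ : ∀ S → ∃ (_∈ S) → a * r₁ + b * r₂ ≤ (a + b) * reserving n R S U →
      noCollision (suc n) ((a , S₁) ∷ (b , S₂) ∷ R) U ≤ noCollision (suc n) ((a + b , S) ∷ R) U
    merged-≤ S x∈S ≤merged = begin
      noCollision (suc n) ((a , S₁) ∷ (b , S₂) ∷ R) U
        ≡⟨ noCollision-overlapping-pair n a b S₁ S₂ R U o ⟩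
      noCollision (suc n) R U + fromℕ (suc n) * (a * r₁ + b * r₂)
        ≤⟨ ℚ.+-monoʳ-≤ (noCollision (suc n) R U) (*-monoˡ-≤-0≤ (0≤fromℕ (suc n)) ≤merged) ⟩
      noCollision (suc n) R U + fromℕ (suc n) * ((a + b) * reserving n R S U)
        ≡⟨ noCollision-∷ n (a + b) S R U x∈S ⟨
      noCollision (suc n) ((a + b , S) ∷ R) U ∎
      where open ℚ.≤-Reasoning
    choose : r₂ ≤ r₁ ⊎ r₁ ≤ r₂ →
      ∃ λ S → P S × noCollision (suc n) ((a , S₁) ∷ (b , S₂) ∷ R) U ≤ noCollision (suc n) ((a + b , S) ∷ R) U
    choose (inj₁ r₂≤r₁) = S₁ , p₁ , merged-≤ S₁ (x , x∈S₁) (begin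
      a * r₁ + b * r₂  ≤⟨ ℚ.+-monoʳ-≤ (a * r₁) (*-monoˡ-≤-0≤ 0≤b r₂≤r₁) ⟩
      a * r₁ + b * r₁  ≡⟨ ℚ.*-distribʳ-+ r₁ a b ⟨
      (a + b) * r₁     ∎)
      where open ℚ.≤-Reasoning
    choose (inj₂ r₁≤r₂) = S₂ , p₂ , merged-≤ S₂ (x , x∈S₂) (begin
      a * r₁ + b * r₂  ≤⟨ ℚ.+-monoˡ-≤ (b * r₂) (*-monoˡ-≤-0≤ 0≤a r₁≤r₂) ⟩
      a * r₂ + b * r₂  ≡⟨ ℚ.*-distribʳ-+ r₂ a b ⟨
      (a + b) * r₂     ∎)
      where open ℚ.≤-Reasoning

  OverlappingPair : List WeightedSet → Set
  OverlappingPair L = ∃₂ λ (e₁ e₂ : WeightedSet) → ∃ λ R → L ↭ e₁ ∷ e₂ ∷ R × Overlap (proj₂ e₁) (proj₂ e₂)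

  disjointFromAll-or-overlap : ∀ S L →
    All (λ (_ , S′) → Disjoint S S′) L ⊎ ∃₂ λ (e : WeightedSet) R → L ↭ e ∷ R × Overlap S (proj₂ e)
  disjointFromAll-or-overlap S []            = inj₁ []
  disjointFromAll-or-overlap S ((w , S′) ∷ L) with disjoint S S′ in eq | disjointFromAll-or-overlap S L
  ... | false | _                       = inj₂ (_ , L , ↭-refl , disjoint-false⇒Overlap eq)
  ... | true  | inj₁ S#L               = inj₁ (disjoint-true⇒Disjoint {S} eq ∷ S#L)
  ... | true  | inj₂ (e , R , L↭ , o)  = inj₂ (e , _ ∷ R , ↭-trans (↭-prep _ L↭) (↭-swap _ _ ↭-refl) , o)

  clique-or-overlappingPair : ∀ L → Clique L ⊎ OverlappingPair L
  clique-or-overlappingPair []      = inj₁ []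
  clique-or-overlappingPair (e ∷ L) with disjointFromAll-or-overlap (proj₂ e) L | clique-or-overlappingPair L
  ... | inj₂ (e′ , R , L↭ , o)  | _        = inj₂ (e , e′ , R , ↭-prep e L↭ , o)
  ... | inj₁ e#L                | inj₁ cl  = inj₁ (e#L ∷ cl)
  ... | inj₁ _                  | inj₂ (e₁ , e₂ , R , L↭ , o) =
    inj₂ (e₁ , e₂ , e ∷ R , ↭-trans (↭-prep e L↭) (↭-trans (↭-swap e e₁ ↭-refl) (↭-prep e₁ (↭-swap e e₂ ↭-refl))) , o)

  module _ {P : List ℕ → Set} where

    Admissible : List WeightedSet → Set
    Admissible = All (λ (w , S) → 0ℚ ≤ w × P S)

    mergeToClique : ∀ n L U → Admissible L →
      ∃ λ L′ → Clique L′ × Admissible L′ × sumMap proj₁ L′ ≡ sumMap proj₁ L × noCollision n L U ≤ noCollision n L′ U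
    mergeToClique n L U = go (length L) L ℕ.≤-refl
      where
      shorter : ∀ {k L e₁ e₂ R} → L ↭ e₁ ∷ e₂ ∷ R → length L ℕ.≤ suc k → suc (length R) ℕ.≤ k
      shorter L↭ len≤ = ℕ.≤-pred (ℕ.≤-trans (ℕ.≤-reflexive (sym (↭.↭-length L↭))) len≤)
      go : ∀ k L → length L ℕ.≤ k → Admissible L →
        ∃ λ L′ → Clique L′ × Admissible L′ × sumMap proj₁ L′ ≡ sumMap proj₁ L × noCollision n L U ≤ noCollision n L′ U
      go k L len≤ ok with clique-or-overlappingPair L
      ... | inj₁ clique = L , clique , ok , refl , ℚ.≤-refl
      go zero    L len≤ ok | inj₂ (_ , _ , _ , L↭ , _) with () ← ℕ.≤-trans (ℕ.≤-reflexive (sym (↭.↭-length L↭))) len≤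
      go (suc k) L len≤ ok | inj₂ ((a , S₁) , (b , S₂) , R , L↭ , o)
        with (0≤a , p₁) ∷ (0≤b , p₂) ∷ R-ok ← ↭.All-resp-↭ L↭ ok
        with S , p , merge-≤ ← noCollision-merge n a b S₁ S₂ R U 0≤a 0≤b o p₁ p₂
        with L′ , clique , ok′ , total′ , ≤′ ← go k ((a + b , S) ∷ R) (shorter L↭ len≤) ((0≤+ 0≤a 0≤b , p) ∷ R-ok) =
        L′ , clique , ok′ , total-preserved , ≤-preserved
        where
        total-preserved : sumMap proj₁ L′ ≡ sumMap proj₁ L
        total-preserved = trans total′ (trans (ℚ.+-assoc a b _) (sym (sumMap-↭ proj₁ L↭)))
        ≤-preserved : noCollision n L U ≤ noCollision n L′ U
        ≤-preserved = ℚ.≤-trans (ℚ.≤-reflexive (noCollision-resp-↭ˡ n U L↭)) (ℚ.≤-trans merge-≤ ≤′)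

  -- Maclaurin's inequality

  falling : ℕ → ℕ → ℚ
  falling k       zero    = 1ℚ
  falling zero    (suc n) = 0ℚ
  falling (suc k) (suc n) = fromℕ (suc k) * falling k n

  0≤falling : ∀ k n → 0ℚ ≤ falling k n
  0≤falling k       zero    = 0≤1
  0≤falling zero    (suc n) = ℚ.≤-refl
  0≤falling (suc k) (suc n) = 0≤* (0≤fromℕ (suc k)) (0≤falling k n)

  falling-pascal : ∀ k n → falling (suc k) (suc n) ≡ falling k (suc n) + fromℕ (suc n) * falling k n
  falling-pascal zero    zero    = refl
  falling-pascal zero    (suc n) = lemma (fromℕ (suc (suc n)))
    where
    lemma : ∀ m → (1ℚ + 0ℚ) * 0ℚ ≡ 0ℚ + m * 0ℚ
    lemma = solve-∀ ℚ-ring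
  falling-pascal (suc k) zero    = lemma (fromℕ k)
    where
    lemma : ∀ k → (1ℚ + (1ℚ + k)) * 1ℚ ≡ (1ℚ + k) * 1ℚ + (1ℚ + 0ℚ) * 1ℚ
    lemma = solve-∀ ℚ-ring
  falling-pascal (suc k) (suc n) = begin
    k₂ * (k₁ * f)                      ≡⟨ expand k₁ f ⟩
    k₁ * (k₁ * f) + k₁ * f              ≡⟨ cong (λ g → k₁ * g + k₁ * f) (falling-pascal k n) ⟩
    k₁ * (falling k (suc n) + n₁ * f) + k₁ * f   ≡⟨ collect k₁ (falling k (suc n)) (fromℕ n) f ⟩
    k₁ * falling k (suc n) + n₂ * (k₁ * f) ∎
    where
    open ≡-Reasoning
    f  = falling k n
    k₁ = fromℕ (suc k)
    k₂ = fromℕ (suc (suc k))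
    n₁ = fromℕ (suc n)
    n₂ = fromℕ (suc (suc n))
    expand : ∀ k₁ f → (1ℚ + k₁) * (k₁ * f) ≡ k₁ * (k₁ * f) + k₁ * f
    expand = solve-∀ ℚ-ring
    collect : ∀ k₁ g n f → k₁ * (g + (1ℚ + n) * f) + k₁ * f ≡ k₁ * g + (1ℚ + (1ℚ + n)) * (k₁ * f)
    collect = solve-∀ ℚ-ring

  elemSym-replicate : ∀ k n x → elemSym n (replicate k x) ≡ falling k n * x ^ n
  elemSym-replicate zero    zero    x = refl
  elemSym-replicate zero    (suc n) x = sym (ℚ.*-zeroˡ (x * x ^ n))
  elemSym-replicate (suc k) zero    x = refl
  elemSym-replicate (suc k) (suc n) x = begin
    elemSym (suc n) (replicate k x) + fromℕ (suc n) * (x * elemSym n (replicate k x))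
      ≡⟨ cong₂ (λ a b → a + fromℕ (suc n) * (x * b)) (elemSym-replicate k (suc n) x) (elemSym-replicate k n x) ⟩
    falling k (suc n) * (x * x ^ n) + fromℕ (suc n) * (x * (falling k n * x ^ n))
      ≡⟨ factor (falling k (suc n)) (fromℕ (suc n)) (falling k n) x (x ^ n) ⟩
    (falling k (suc n) + fromℕ (suc n) * falling k n) * (x * x ^ n)
      ≡⟨ cong (_* (x * x ^ n)) (falling-pascal k n) ⟨
    falling (suc k) (suc n) * x ^ suc n ∎
    where
    open ≡-Reasoning
    factor : ∀ a m b x p → a * (x * p) + m * (x * (b * p)) ≡ (a + m * b) * (x * p)
    factor = solve-∀ ℚ-ring

  elemSym-0∷ : ∀ n xs → elemSym n (0ℚ ∷ xs) ≡ elemSym n xs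
  elemSym-0∷ zero    xs = refl
  elemSym-0∷ (suc n) xs = lemma (elemSym (suc n) xs) (fromℕ (suc n)) (elemSym n xs)
    where
    lemma : ∀ a m b → a + m * (0ℚ * b) ≡ a
    lemma = solve-∀ ℚ-ring

  0≤x*x : ∀ x → 0ℚ ≤ x * x
  0≤x*x x with ℚ.≤-total 0ℚ x
  ... | inj₁ 0≤x = 0≤* 0≤x 0≤x
  ... | inj₂ x≤0 = ℚ.nonNegative⁻¹ (x * x) {{ℚ.nonPos*nonPos⇒nonPos x {{ℚ.nonPositive x≤0}} x {{ℚ.nonPositive x≤0}}}}

  0≤^ : ∀ {x} n → 0ℚ ≤ x → 0ℚ ≤ x ^ n
  0≤^ zero    0≤x = 0≤1
  0≤^ (suc n) 0≤x = 0≤* 0≤x (0≤^ n 0≤x)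

  ≤-+-0≤ : ∀ a {c} → 0ℚ ≤ c → a ≤ a + c
  ≤-+-0≤ a 0≤c = ℚ.≤-trans (ℚ.≤-reflexive (sym (ℚ.+-identityʳ a))) (ℚ.+-monoʳ-≤ a 0≤c)

  ^-above-tangent : ∀ p {u v} → 0ℚ ≤ u → 0ℚ ≤ v → u ^ suc p + fromℕ (suc p) * u ^ p * (v - u) ≤ v ^ suc p
  ^-above-tangent zero    {u} {v} _ _ = ℚ.≤-reflexive (lemma u v)
    where
    lemma : ∀ u v → u * 1ℚ + (1ℚ + 0ℚ) * 1ℚ * (v - u) ≡ v * 1ℚ
    lemma = solve-∀ ℚ-ring
  ^-above-tangent (suc p) {u} {v} 0≤u 0≤v = begin
    u ^ suc (suc p) + fromℕ (suc (suc p)) * u ^ suc p * (v - u)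
      ≤⟨ ≤-+-0≤ _ (0≤* (0≤* (0≤fromℕ (suc p)) (0≤^ p 0≤u)) (0≤x*x (v - u))) ⟩
    u ^ suc (suc p) + fromℕ (suc (suc p)) * u ^ suc p * (v - u) + fromℕ (suc p) * u ^ p * ((v - u) * (v - u))
      ≡⟨ lemma u v (u ^ p) (fromℕ p) ⟩
    v * (u ^ suc p + fromℕ (suc p) * u ^ p * (v - u))
      ≤⟨ *-monoˡ-≤-0≤ 0≤v (^-above-tangent p 0≤u 0≤v) ⟩
    v ^ suc (suc p) ∎
    where
    open ℚ.≤-Reasoning
    lemma : ∀ u v uᵖ p → u * (u * uᵖ) + (1ℚ + (1ℚ + p)) * (u * uᵖ) * (v - u) + (1ℚ + p) * uᵖ * ((v - u) * (v - u))
                          ≡ v * (u * uᵖ + (1ℚ + p) * uᵖ * (v - u))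
    lemma = solve-∀ ℚ-ring

  mean : List ℚ → ℚ
  mean xs = sumℚ xs * uniformWeight (length xs)

  sumℚ≡length*mean : ∀ xs → sumℚ xs ≡ fromℕ (length xs) * mean xs
  sumℚ≡length*mean []         = refl
  sumℚ≡length*mean xs@(_ ∷ _) = begin
    sumℚ xs                                ≡⟨ ℚ.*-identityʳ (sumℚ xs) ⟨
    sumℚ xs * 1ℚ                           ≡⟨ cong (sumℚ xs *_) (fromℕ*uniformWeight (length xs)) ⟨
    sumℚ xs * (fromℕ (length xs) * uniformWeight (length xs))  ≡⟨ lemma (sumℚ xs) (fromℕ (length xs)) (uniformWeight (length xs)) ⟩
    fromℕ (length xs) * mean xs            ∎
    where
    open ≡-Reasoning
    lemma : ∀ s k w → s * (k * w) ≡ k * (s * w)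
    lemma = solve-∀ ℚ-ring

  0≤sumℚ : ∀ {xs} → All (0ℚ ≤_) xs → 0ℚ ≤ sumℚ xs
  0≤sumℚ []           = ℚ.≤-refl
  0≤sumℚ (0≤x ∷ 0≤xs) = 0≤+ 0≤x (0≤sumℚ 0≤xs)

  0≤uniformWeight : ∀ k → 0ℚ ≤ uniformWeight k
  0≤uniformWeight zero    = ℚ.≤-refl
  0≤uniformWeight (suc k) = ℚ.nonNegative⁻¹ _ {{ℚ.normalize-nonNeg 1 (suc k)}}

  -- Maclaurin's inequality e_n(xs) ≤ (k choose n) (e_1(xs) / k) ^ n for k = length xs, scaled
  -- by n!. Induction on xs: compare the tail with its own mean u₀, then use Bernoulli.
  maclaurin : ∀ xs {u} n → All (0ℚ ≤_) xs → 0ℚ ≤ u → sumℚ xs ≡ fromℕ (length xs) * u →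
    elemSym n xs ≤ falling (length xs) n * u ^ n
  maclaurin []           zero    _ _ _ = ℚ.≤-refl
  maclaurin []       {u} (suc n) _ _ _ = ℚ.≤-reflexive (sym (ℚ.*-zeroˡ (u * u ^ n)))
  maclaurin (x ∷ ys)     zero    _ _ _ = ℚ.≤-refl
  maclaurin (x ∷ ys) {u} (suc p) (0≤x ∷ 0≤ys) 0≤u sum≡ = begin
    elemSym (suc p) ys + m * (x * elemSym p ys)
      ≤⟨ ℚ.+-mono-≤ (maclaurin ys (suc p) 0≤ys 0≤u₀ sum-ys)
                    (*-monoˡ-≤-0≤ (0≤fromℕ (suc p)) (*-monoˡ-≤-0≤ 0≤x (maclaurin ys p 0≤ys 0≤u₀ sum-ys))) ⟩
    falling k (suc p) * u₀ ^ suc p + m * (x * (falling k p * u₀ ^ p))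
      ≡⟨ unfold (falling k (suc p)) m (falling k p) x (fromℕ k) u₀ (u₀ ^ p) ⟩
    φ (falling k (suc p) + m * falling k p) (x + fromℕ k * u₀)
      ≡⟨ cong₂ φ (sym (falling-pascal k p)) head≡ ⟩
    φ (falling (suc k) (suc p)) (fromℕ (suc k) * u)
      ≡⟨ fold (falling k p) m (fromℕ k) u u₀ (u₀ ^ p) ⟩
    falling (suc k) (suc p) * (u₀ ^ suc p + m * u₀ ^ p * (u - u₀))
      ≤⟨ *-monoˡ-≤-0≤ (0≤falling (suc k) (suc p)) (^-above-tangent p 0≤u₀ 0≤u) ⟩
    falling (suc k) (suc p) * u ^ suc p ∎
    where
    open ℚ.≤-Reasoning
    k  = length ys
    m  = fromℕ (suc p)
    u₀ = mean ys
    0≤u₀ : 0ℚ ≤ u₀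
    0≤u₀ = 0≤* (0≤sumℚ 0≤ys) (0≤uniformWeight k)
    sum-ys : sumℚ ys ≡ fromℕ k * u₀
    sum-ys = sumℚ≡length*mean ys
    head≡ : x + fromℕ k * u₀ ≡ fromℕ (suc k) * u
    head≡ = trans (cong (x +_) (sym sum-ys)) sum≡
    -- falling-pascal and head≡ enter by rewriting the two arguments of φ.
    φ : ℚ → ℚ → ℚ
    φ a b = (a - m * falling k p) * u₀ ^ suc p + m * ((b - fromℕ k * u₀) * (falling k p * u₀ ^ p))
    unfold : ∀ a m f x k u₀ uᵖ → a * (u₀ * uᵖ) + m * (x * (f * uᵖ))
                                ≡ ((a + m * f) - m * f) * (u₀ * uᵖ) + m * (((x + k * u₀) - k * u₀) * (f * uᵖ))
    unfold = solve-∀ ℚ-ring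
    fold : ∀ f m k u u₀ uᵖ → (((1ℚ + k) * f) - m * f) * (u₀ * uᵖ) + m * (((1ℚ + k) * u - k * u₀) * (f * uᵖ))
                             ≡ ((1ℚ + k) * f) * (u₀ * uᵖ + m * uᵖ * (u - u₀))
    fold = solve-∀ ℚ-ring

  elemSym-replicate-0++ : ∀ n z xs → elemSym n (replicate z 0ℚ ++ xs) ≡ elemSym n xs
  elemSym-replicate-0++ n zero    xs = refl
  elemSym-replicate-0++ n (suc z) xs = trans (elemSym-0∷ n (replicate z 0ℚ ++ xs)) (elemSym-replicate-0++ n z xs)

  sumℚ-replicate-0++ : ∀ z xs → sumℚ (replicate z 0ℚ ++ xs) ≡ sumℚ xs
  sumℚ-replicate-0++ zero    xs = refl
  sumℚ-replicate-0++ (suc z) xs = trans (ℚ.+-identityˡ _) (sumℚ-replicate-0++ z xs)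

  elemSym-≤-replicate : ∀ n xs {k u} → length xs ℕ.≤ k → All (0ℚ ≤_) xs → 0ℚ ≤ u → sumℚ xs ≡ fromℕ k * u →
    elemSym n xs ≤ elemSym n (replicate k u)
  elemSym-≤-replicate n xs {k} {u} |xs|≤k 0≤xs 0≤u sum≡ = begin
    elemSym n xs                    ≡⟨ elemSym-replicate-0++ n z xs ⟨
    elemSym n ys                    ≤⟨ maclaurin ys n 0≤ys 0≤u (trans (sumℚ-replicate-0++ z xs) (trans sum≡ (cong (λ l → fromℕ l * u) (sym |ys|≡k)))) ⟩
    falling (length ys) n * u ^ n   ≡⟨ cong (λ l → falling l n * u ^ n) |ys|≡k ⟩
    falling k n * u ^ n             ≡⟨ elemSym-replicate k n u ⟨
    elemSym n (replicate k u)       ∎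
    where
    open ℚ.≤-Reasoning
    z  = k ℕ.∸ length xs
    ys = replicate z 0ℚ ++ xs
    |ys|≡k : length ys ≡ k
    |ys|≡k = trans (List.length-++ (replicate z 0ℚ)) (trans (cong (ℕ._+ length xs) (List.length-replicate z)) (ℕ.m∸n+n≡m |xs|≤k))
    0≤ys : All (0ℚ ≤_) ys
    0≤ys = All.++⁺ (All.replicate⁺ z ℚ.≤-refl) 0≤xs

  -- Collision probability under uniform demand

  prefixes : ℕ → List (ℚ × List ℕ) → List WeightedSet
  prefixes h = map (λ (w , π) → w , take h π)

  all-disjoint≡disjoint-concat : ∀ S Ts → all (disjoint S) Ts ≡ disjoint S (concat Ts)
  all-disjoint≡disjoint-concat S []       = sym (disjoint-[]ʳ S)
  all-disjoint≡disjoint-concat S (T ∷ Ts) =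
    trans (cong (disjoint S T ∧_) (all-disjoint≡disjoint-concat S Ts)) (sym (disjoint-++ʳ S T (concat Ts)))

  collProbAux-replicate : ∀ h A k acc →
    collProbAux A (replicate k h) acc ≡ sumMap proj₁ A ^ k - 𝟙 (pairwiseDisjoint acc) * noCollision k (prefixes h A) (concat acc)
  collProbAux-replicate h A zero acc with pairwiseDisjoint acc
  ... | true  = refl
  ... | false = refl
  collProbAux-replicate h A (suc k) acc = begin
    sumMap (λ (w , π) → w * collProbAux A (replicate k h) (take h π ∷ acc)) A
      ≡⟨ sumMap-cong A (λ {(w , π)} _ → cong (w *_) (trans (collProbAux-replicate h A k (take h π ∷ acc))
           (cong (λ b → Wᵏ - 𝟙 b * noCollision k L (take h π ++ U))
                 (cong (_∧ pairwiseDisjoint acc) (all-disjoint≡disjoint-concat (take h π) acc))))) ⟩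
    sumMap (λ (w , π) → w * (Wᵏ - 𝟙 (disjoint (take h π) U ∧ pairwiseDisjoint acc) * noCollision k L (take h π ++ U))) A
      ≡⟨ sumMap-cong A (λ {(w , π)} _ → trans (cong (λ i → w * (Wᵏ - i * noCollision k L (take h π ++ U))) (𝟙-∧ (disjoint (take h π) U) (pairwiseDisjoint acc)))
                                              (expand w Wᵏ (𝟙 (disjoint (take h π) U)) ok (noCollision k L (take h π ++ U)))) ⟩
    sumMap (λ (w , π) → Wᵏ * w + (- ok) * (w * reserving k L (take h π) U)) A
      ≡⟨ trans (sumMap-+ _ _ A) (cong₂ _+_ (sumMap-*ˡ Wᵏ proj₁ A) (sumMap-*ˡ (- ok) _ A)) ⟩
    Wᵏ * W + (- ok) * sumMap (λ (w , π) → w * reserving k L (take h π) U) A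
      ≡⟨ cong (λ g → Wᵏ * W + (- ok) * g) (sumMap-map (λ (w , S) → w * reserving k L S U) _ A) ⟨
    Wᵏ * W + (- ok) * noCollision (suc k) L U
      ≡⟨ collect Wᵏ W ok (noCollision (suc k) L U) ⟩
    W ^ suc k - ok * noCollision (suc k) L U ∎
    where
    open ≡-Reasoning
    W  = sumMap proj₁ A
    Wᵏ = W ^ k
    L  = prefixes h A
    U  = concat acc
    ok = 𝟙 (pairwiseDisjoint acc)
    expand : ∀ w P i o g → w * (P - (i * o) * g) ≡ P * w + (- o) * (w * (i * g))
    expand = solve-∀ ℚ-ring
    collect : ∀ P W o g → P * W + (- o) * g ≡ W * P - o * g
    collect = solve-∀ ℚ-ring

  1^n≡1 : ∀ n → 1ℚ ^ n ≡ 1ℚ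
  1^n≡1 zero    = refl
  1^n≡1 (suc n) = trans (ℚ.*-identityˡ (1ℚ ^ n)) (1^n≡1 n)

  totalWeight≡1 : ∀ {m} (A : Algorithm m) → sumMap proj₁ (Algorithm.support A) ≡ 1ℚ
  totalWeight≡1 A = trans (List.foldr-map _+_ proj₁ 0ℚ (Algorithm.support A)) (Algorithm.total A)

  collProb-replicate : ∀ {m} (A : Algorithm m) h n →
    collProb A (replicate n h) ≡ 1ℚ - noCollision n (prefixes h (Algorithm.support A)) []
  collProb-replicate A h n = trans (collProbAux-replicate h (Algorithm.support A) n [])
    (cong₂ (λ P g → P - g) (trans (cong (_^ n) (totalWeight≡1 A)) (1^n≡1 n)) (ℚ.*-identityˡ (noCollision n (prefixes h (Algorithm.support A)) [])))

  insertAll-↭ : ∀ (x : A) ys {zs} → zs ∈ insertAll x ys → zs ↭ x ∷ ys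
  insertAll-↭ x []       (here refl) = ↭-refl
  insertAll-↭ x (y ∷ ys) (here refl) = ↭-refl
  insertAll-↭ x (y ∷ ys) (there zs∈) with _ , zs′∈ , refl ← ∈-map⁻ (y ∷_) zs∈ =
    ↭-trans (↭-prep y (insertAll-↭ x ys zs′∈)) (↭-swap y x ↭-refl)

  perms-↭ : ∀ (xs : List A) {ys} → ys ∈ perms xs → ys ↭ xs
  perms-↭ []       (here refl) = ↭-refl
  perms-↭ (x ∷ xs) ys∈
    with _ , ys∈ins , ins∈ ← ∈-concat⁻′ (map (insertAll x) (perms xs)) ys∈
    with zs , zs∈ , refl ← ∈-map⁻ (insertAll x) ins∈ =
    ↭-trans (insertAll-↭ x zs ys∈ins) (↭-prep x (perms-↭ xs zs∈))

  length-insertAll : ∀ (x : A) ys → length (insertAll x ys) ≡ suc (length ys)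
  length-insertAll x []       = refl
  length-insertAll x (y ∷ ys) = cong suc (trans (List.length-map (y ∷_) (insertAll x ys)) (length-insertAll x ys))

  length-perms-nonZero : ∀ (xs : List A) → ℕ.NonZero (length (perms xs))
  length-perms-nonZero []       = _
  length-perms-nonZero (x ∷ xs) with perms xs | length-perms-nonZero xs
  ... | ys ∷ yss | _ = nonZero ys
    where
    nonZero : ∀ ys → ℕ.NonZero (length (insertAll x ys ++ concatMap (insertAll x) yss))
    nonZero []      = _
    nonZero (_ ∷ _) = _

  fromℕ-length : ∀ (xs : List A) → fromℕ (length xs) ≡ sumMap (λ _ → 1ℚ) xs
  fromℕ-length []       = refl
  fromℕ-length (x ∷ xs) = cong (1ℚ +_) (fromℕ-length xs)

  sumMap-const : ∀ c (xs : List A) → sumMap (λ _ → c) xs ≡ fromℕ (length xs) * c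
  sumMap-const c []       = sym (ℚ.*-zeroˡ c)
  sumMap-const c (x ∷ xs) = trans (cong (c +_) (sumMap-const c xs)) (lemma c (fromℕ (length xs)))
    where
    lemma : ∀ c k → c + k * c ≡ (1ℚ + k) * c
    lemma = solve-∀ ℚ-ring

  headOr : A → List A → A
  headOr d []      = d
  headOr d (x ∷ _) = x

  sumMap-head-insertAll : ∀ (g : A → ℚ) d x ys →
    sumMap (g ∘ headOr d) (insertAll x ys) ≡ g x + fromℕ (length ys) * g (headOr d ys)
  sumMap-head-insertAll g d x []       = lemma (g x) (g d)
    where
    lemma : ∀ a b → a + 0ℚ ≡ a + 0ℚ * b
    lemma = solve-∀ ℚ-ring
  sumMap-head-insertAll g d x (y ∷ ys) = cong (g x +_) (begin
    sumMap (g ∘ headOr d) (map (y ∷_) (insertAll x ys))   ≡⟨ sumMap-map (g ∘ headOr d) (y ∷_) (insertAll x ys) ⟩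
    sumMap (λ _ → g y) (insertAll x ys)                   ≡⟨ sumMap-const (g y) (insertAll x ys) ⟩
    fromℕ (length (insertAll x ys)) * g y                 ≡⟨ cong (λ l → fromℕ l * g y) (length-insertAll x ys) ⟩
    fromℕ (suc (length ys)) * g y                         ∎)
    where open ≡-Reasoning

  -- Every element of xs is the head of equally many permutations.
  sumMap-head-perms : ∀ (g : A → ℚ) d xs →
    sumMap (g ∘ headOr d) (perms xs) * fromℕ (length xs) ≡ fromℕ (length (perms xs)) * sumMap g xs
  sumMap-head-perms g d []       = lemma (g d)
    where
    lemma : ∀ a → (a + 0ℚ) * 0ℚ ≡ (1ℚ + 0ℚ) * 0ℚ
    lemma = solve-∀ ℚ-ring
  sumMap-head-perms g d (x ∷ xs) = begin
    sumMap (g ∘ headOr d) (concatMap (insertAll x) (perms xs)) * (1ℚ + r)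
      ≡⟨ cong (_* (1ℚ + r)) (trans (sumMap-concatMap (g ∘ headOr d) (insertAll x) (perms xs)) (sumMap-cong (perms xs) λ {zs} zs∈ →
           trans (sumMap-head-insertAll g d x zs) (cong (λ l → g x + fromℕ l * g (headOr d zs)) (↭.↭-length (perms-↭ xs zs∈))))) ⟩
    sumMap (λ zs → g x + r * g (headOr d zs)) (perms xs) * (1ℚ + r)
      ≡⟨ cong (_* (1ℚ + r)) (trans (sumMap-+ _ _ (perms xs)) (cong₂ _+_ (sumMap-const (g x) (perms xs)) (sumMap-*ˡ r _ (perms xs)))) ⟩
    (p * g x + r * s) * (1ℚ + r)
      ≡⟨ split p (g x) r s ⟩
    p * g x * (1ℚ + r) + (1ℚ + r) * (s * r)
      ≡⟨ cong (λ t → p * g x * (1ℚ + r) + (1ℚ + r) * t) (sumMap-head-perms g d xs) ⟩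
    p * g x * (1ℚ + r) + (1ℚ + r) * (p * sumMap g xs)
      ≡⟨ merge p (g x) r (sumMap g xs) ⟩
    (p * (1ℚ + r)) * (g x + sumMap g xs)
      ≡⟨ cong (_* (g x + sumMap g xs)) count ⟨
    fromℕ (length (perms (x ∷ xs))) * sumMap g (x ∷ xs) ∎
    where
    open ≡-Reasoning
    r = fromℕ (length xs)
    p = fromℕ (length (perms xs))
    s = sumMap (g ∘ headOr d) (perms xs)
    count : fromℕ (length (perms (x ∷ xs))) ≡ p * (1ℚ + r)
    count = begin
      fromℕ (length (concatMap (insertAll x) (perms xs)))
        ≡⟨ trans (fromℕ-length (concatMap (insertAll x) (perms xs))) (sumMap-concatMap (λ _ → 1ℚ) (insertAll x) (perms xs)) ⟩
      sumMap (sumMap (λ _ → 1ℚ) ∘ insertAll x) (perms xs)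
        ≡⟨ sumMap-cong (perms xs) (λ {zs} zs∈ → trans (sym (fromℕ-length (insertAll x zs)))
             (cong fromℕ (trans (length-insertAll x zs) (cong suc (↭.↭-length (perms-↭ xs zs∈)))))) ⟩
      sumMap (λ _ → 1ℚ + r) (perms xs)
        ≡⟨ sumMap-const (1ℚ + r) (perms xs) ⟩
      p * (1ℚ + r) ∎
    split : ∀ p a r s → (p * a + r * s) * (1ℚ + r) ≡ p * a * (1ℚ + r) + (1ℚ + r) * (s * r)
    split = solve-∀ ℚ-ring
    merge : ∀ p a r t → p * a * (1ℚ + r) + (1ℚ + r) * (p * t) ≡ (p * (1ℚ + r)) * (a + t)
    merge = solve-∀ ℚ-ring

  perms-head-uniform : ∀ (g : A → ℚ) d xs .{{_ : ℕ.NonZero (length xs)}} →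
    uniformWeight (length (perms xs)) * sumMap (g ∘ headOr d) (perms xs) ≡ uniformWeight (length xs) * sumMap g xs
  perms-head-uniform g d xs = begin
    wₚ * s                         ≡⟨ ℚ.*-identityʳ (wₚ * s) ⟨
    wₚ * s * 1ℚ                    ≡⟨ cong (wₚ * s *_) (fromℕ*uniformWeight (length xs)) ⟨
    wₚ * s * (k * wₖ)              ≡⟨ lemma₁ wₚ s k wₖ ⟩
    wₚ * (s * k) * wₖ              ≡⟨ cong (λ t → wₚ * t * wₖ) (sumMap-head-perms g d xs) ⟩
    wₚ * (p * sumMap g xs) * wₖ    ≡⟨ lemma₂ wₚ p (sumMap g xs) wₖ ⟩
    (p * wₚ) * (wₖ * sumMap g xs)  ≡⟨ cong (_* (wₖ * sumMap g xs)) (fromℕ*uniformWeight (length (perms xs)) {{length-perms-nonZero xs}}) ⟩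
    1ℚ * (wₖ * sumMap g xs)        ≡⟨ ℚ.*-identityˡ (wₖ * sumMap g xs) ⟩
    wₖ * sumMap g xs               ∎
    where
    open ≡-Reasoning
    s  = sumMap (g ∘ headOr d) (perms xs)
    k  = fromℕ (length xs)
    p  = fromℕ (length (perms xs))
    wₖ = uniformWeight (length xs)
    wₚ = uniformWeight (length (perms xs))
    lemma₁ : ∀ w s k v → w * s * (k * v) ≡ w * (s * k) * v
    lemma₁ = solve-∀ ℚ-ring
    lemma₂ : ∀ w p t v → w * (p * t) * v ≡ (p * w) * (v * t)
    lemma₂ = solve-∀ ℚ-ring

  applyUpTo-cong : ∀ {f g : ℕ → A} n → (∀ i → f i ≡ g i) → applyUpTo f n ≡ applyUpTo g n
  applyUpTo-cong zero    f≗g = refl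
  applyUpTo-cong (suc n) f≗g = cong₂ _∷_ (f≗g 0) (applyUpTo-cong n (f≗g ∘ suc))

  applyUpTo-+ : ∀ (f : ℕ → A) a n → applyUpTo f (a ℕ.+ n) ≡ applyUpTo f a ++ applyUpTo (f ∘ (a ℕ.+_)) n
  applyUpTo-+ f zero    n = refl
  applyUpTo-+ f (suc a) n = cong (f 0 ∷_) (applyUpTo-+ (f ∘ suc) a n)

  concatMap-↭ : ∀ (f : A → List B) {xs ys} → xs ↭ ys → concatMap f xs ↭ concatMap f ys
  concatMap-↭ f Perm.refl          = ↭-refl
  concatMap-↭ f (Perm.prep x p)   = ↭.++⁺ˡ (f x) (concatMap-↭ f p)
  concatMap-↭ f (Perm.swap x y p) = ↭-trans (↭.shifts (f x) (f y)) (↭.++⁺ˡ (f y) (↭.++⁺ˡ (f x) (concatMap-↭ f p)))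
  concatMap-↭ f (Perm.trans p q)  = ↭-trans (concatMap-↭ f p) (concatMap-↭ f q)

  take-length-++ : ∀ (xs ys : List A) → take (length xs) (xs ++ ys) ≡ xs
  take-length-++ []       ys = refl
  take-length-++ (x ∷ xs) ys = cong (x ∷_) (take-length-++ xs ys)

  map-const : ∀ (c : B) (xs : List A) → map (λ _ → c) xs ≡ replicate (length xs) c
  map-const c []       = refl
  map-const c (x ∷ xs) = cong (c ∷_) (map-const c xs)

  module _ (h : ℕ) .{{_ : ℕ.NonZero h}} where

    concatMap-bin : ∀ c b → concatMap (bin h) (applyUpTo (c ℕ.+_) b) ≡ applyUpTo (λ r → suc (c ℕ.* h ℕ.+ r)) (b ℕ.* h)
    concatMap-bin c zero    = refl
    concatMap-bin c (suc b) = begin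
      bin h (c ℕ.+ 0) ++ concatMap (bin h) (applyUpTo (λ i → c ℕ.+ suc i) b)
        ≡⟨ cong₂ _++_ (cong (bin h) (ℕ.+-identityʳ c))
                      (trans (cong (concatMap (bin h)) (applyUpTo-cong b (ℕ.+-suc c))) (concatMap-bin (suc c) b)) ⟩
      bin h c ++ applyUpTo (λ r → suc (suc c ℕ.* h ℕ.+ r)) (b ℕ.* h)
        ≡⟨ cong (bin h c ++_) (applyUpTo-cong (b ℕ.* h) (λ r → cong suc (shift c r))) ⟩
      bin h c ++ applyUpTo (λ r → suc (c ℕ.* h ℕ.+ (h ℕ.+ r))) (b ℕ.* h)
        ≡⟨ applyUpTo-+ (λ r → suc (c ℕ.* h ℕ.+ r)) h (b ℕ.* h) ⟨
      applyUpTo (λ r → suc (c ℕ.* h ℕ.+ r)) (suc b ℕ.* h) ∎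
      where
      open ≡-Reasoning
      shift : ∀ c r → suc c ℕ.* h ℕ.+ r ≡ c ℕ.* h ℕ.+ (h ℕ.+ r)
      shift c r = trans (cong (ℕ._+ r) (ℕ.+-comm h (c ℕ.* h))) (ℕ.+-assoc (c ℕ.* h) h r)

    ∈-bin⇒index : ∀ {x} j → x ∈ bin h j → ℕ.pred x / h ≡ j
    ∈-bin⇒index j x∈ with r , r<h , refl ← ∈-applyUpTo⁻ (λ r → suc (j ℕ.* h ℕ.+ r)) x∈ =
      trans (+-distrib-/-∣ˡ r (n∣m*n j)) (trans (cong₂ ℕ._+_ (m*n/n≡m j h) (m<n⇒m/n≡0 r<h)) (ℕ.+-identityʳ j))

    bin-disjoint : ∀ {i j} → i ≢ j → Disjoint (bin h i) (bin h j)
    bin-disjoint {i} {j} i≢j (x∈i , x∈j) = i≢j (trans (sym (∈-bin⇒index i x∈i)) (∈-bin⇒index j x∈j))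

  bin-nonEmpty : ∀ h .{{_ : ℕ.NonZero h}} j → ∃ (_∈ bin h j)
  bin-nonEmpty (suc h) j = _ , here refl

  ∈-take : ∀ {x : A} n xs → x ∈ take n xs → x ∈ xs
  ∈-take (suc n) (y ∷ xs) (here refl) = here refl
  ∈-take (suc n) (y ∷ xs) (there x∈) = there (∈-take n xs x∈)

  Unique⇒length≤ : ∀ {xs ys : List A} → Unique xs → (∀ {x} → x ∈ xs → x ∈ ys) → length xs ℕ.≤ length ys
  Unique⇒length≤ {xs = []}     _                xs⊆ys = ℕ.z≤n
  Unique⇒length≤ {xs = x ∷ xs} (x∉xs ∷ unique) xs⊆ys with as , bs , refl ← ∈-∃++ (xs⊆ys (here refl)) =
    ℕ.≤-trans (ℕ.s≤s (Unique⇒length≤ unique xs⊆as++bs)) (ℕ.≤-reflexive (sym (↭.↭-length (↭.shift x as bs))))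
    where
    xs⊆as++bs : ∀ {y} → y ∈ xs → y ∈ as ++ bs
    xs⊆as++bs {y} y∈xs with ∈-++⁻ as (xs⊆ys (there y∈xs))
    ... | inj₁ y∈as          = ∈-++⁺ˡ y∈as
    ... | inj₂ (here refl)   = ⊥-elim (All.lookup x∉xs y∈xs refl)
    ... | inj₂ (there y∈bs)  = ∈-++⁺ʳ as y∈bs

  Block : ℕ → ℕ → List ℕ → Set
  Block m h S = Unique S × (∀ {x} → x ∈ S → x ∈ universe m) × length S ≡ h

  take-Block : ∀ {m h π} → h ℕ.≤ m → IsPerm m π → Block m h (take h π)
  take-Block {m} {h} {π} h≤m π↭ =
    Unique.take⁺ h (Unique-resp-↭ (setoid ℕ) (↭⇒↭ₛ (↭-sym π↭)) unique-universe) ,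
    (λ x∈ → ↭.∈-resp-↭ π↭ (∈-take h π x∈)) ,
    trans (List.length-take h π) (trans (cong (h ℕ.⊓_) (trans (↭.↭-length π↭) (List.length-applyUpTo suc m))) (ℕ.m≤n⇒m⊓n≡m h≤m))
    where
    unique-universe : Unique (universe m)
    unique-universe = Unique.applyUpTo⁺₁ suc m (λ i<j _ → ℕ.<⇒≢ i<j ∘ ℕ.suc-injective)

  Block-nonEmpty : ∀ {m h} .{{_ : ℕ.NonZero h}} {S} → Block m h S → ∃ (_∈ S)
  Block-nonEmpty {h = h} {S = []} (_ , _ , 0≡h) = contradiction (sym 0≡h) (ℕ.≢-nonZero⁻¹ h)
  Block-nonEmpty {S = x ∷ S} _              = x , here refl

  prefixes-admissible : ∀ {m h} → h ℕ.≤ m → (A : Algorithm m) → Admissible {Block m h} (prefixes h (Algorithm.support A))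
  prefixes-admissible h≤m A =
    All.map⁺ (All.zipWith (λ (0≤w , π↭) → 0≤w , take-Block h≤m π↭) (Algorithm.nonneg A , Algorithm.arePerms A))

  clique-size : ∀ {m h} .{{_ : ℕ.NonZero h}} L → Clique L → All (Block m h ∘ proj₂) L → length L ℕ.≤ m / h
  clique-size {m} {h} L clique blocks = subst (ℕ._≤ m / h) (m*n/n≡m (length L) h) (/-monoˡ-≤ h (begin
    length L ℕ.* h                   ≡⟨ length-concat L blocks ⟨
    length (concat (map proj₂ L))    ≤⟨ Unique⇒length≤ unique ⊆universe ⟩
    length (universe m)              ≡⟨ List.length-applyUpTo suc m ⟩
    m                                ∎))
    where
    open ℕ.≤-Reasoning
    unique : Unique (concat (map proj₂ L))
    unique = Unique.concat⁺ (All.map⁺ (All.map proj₁ blocks)) (AllPairs.map⁺ clique)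
    ⊆universe : ∀ {x} → x ∈ concat (map proj₂ L) → x ∈ universe m
    ⊆universe x∈ with S , x∈S , S∈ ← ∈-concat⁻′ (map proj₂ L) x∈ with e , e∈ , refl ← ∈-map⁻ proj₂ S∈ =
      proj₁ (proj₂ (All.lookup blocks e∈)) x∈S
    length-concat : ∀ L → All (Block m h ∘ proj₂) L → length (concat (map proj₂ L)) ≡ length L ℕ.* h
    length-concat []      []                          = refl
    length-concat (e ∷ L) ((_ , _ , |S|≡h) ∷ blocks) =
      trans (List.length-++ (proj₂ e)) (cong₂ ℕ._+_ |S|≡h (length-concat L blocks))

  -- Optimality of Bins(h)

  module Bins (m h : ℕ) .{{_ : ℕ.NonZero h}} (h≤m : h ℕ.≤ m) where

    b : ℕ
    b = m / h

    instance
      b-nonZero : ℕ.NonZero b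
      b-nonZero = ℕ.>-nonZero (m≥n⇒m/n>0 h≤m)

    u : ℚ
    u = uniformWeight b

    orders : List (List ℕ)
    orders = perms (upTo b)

    leftovers : List ℕ
    leftovers = applyUpTo (λ r → suc (b ℕ.* h ℕ.+ r)) (m ℕ.∸ b ℕ.* h)

    binsOutput-upTo : binsOutput m h (upTo b) ≡ universe m
    binsOutput-upTo = begin
      concatMap (bin h) (upTo b) ++ leftovers  ≡⟨ cong (_++ leftovers) (concatMap-bin h 0 b) ⟩
      applyUpTo suc (b ℕ.* h) ++ leftovers     ≡⟨ applyUpTo-+ suc (b ℕ.* h) (m ℕ.∸ b ℕ.* h) ⟨
      applyUpTo suc (b ℕ.* h ℕ.+ (m ℕ.∸ b ℕ.* h)) ≡⟨ cong (applyUpTo suc) (ℕ.m+[n∸m]≡n (m/n*n≤m m h)) ⟩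
      universe m                               ∎
      where open ≡-Reasoning

    binsOutput-↭ : ∀ {σ} → σ ∈ orders → binsOutput m h σ ↭ universe m
    binsOutput-↭ σ∈ = ↭-trans (↭.++⁺ʳ leftovers (concatMap-↭ (bin h) (perms-↭ (upTo b) σ∈))) (↭-reflexive binsOutput-upTo)

    take-binsOutput : ∀ {σ} → σ ∈ orders → take h (binsOutput m h σ) ≡ bin h (headOr 0 σ)
    take-binsOutput {[]} σ∈ = contradiction (trans (↭.↭-length (perms-↭ (upTo b) σ∈)) (List.length-upTo b)) (ℕ.≢-nonZero⁻¹ b ∘ sym)
    take-binsOutput {j ∷ σ} σ∈ = begin
      take h ((bin h j ++ concatMap (bin h) σ) ++ leftovers)
        ≡⟨ cong (take h) (List.++-assoc (bin h j) _ leftovers) ⟩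
      take h (bin h j ++ concatMap (bin h) σ ++ leftovers)
        ≡⟨ cong (λ l → take l (bin h j ++ concatMap (bin h) σ ++ leftovers)) (List.length-applyUpTo _ h) ⟨
      take (length (bin h j)) (bin h j ++ concatMap (bin h) σ ++ leftovers)
        ≡⟨ take-length-++ (bin h j) _ ⟩
      bin h j ∎
      where open ≡-Reasoning

    algorithm : Algorithm m
    algorithm = record
      { support  = binsSupport m h
      ; nonneg   = All.map⁺ (tabulate (λ _ → 0≤uniformWeight (length orders)))
      ; total    = trans (sym (List.foldr-map _+_ proj₁ 0ℚ (binsSupport m h))) (begin
          sumMap proj₁ (binsSupport m h)                        ≡⟨ sumMap-map proj₁ _ orders ⟩
          sumMap (λ _ → uniformWeight (length orders)) orders   ≡⟨ sumMap-const _ orders ⟩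
          fromℕ (length orders) * uniformWeight (length orders) ≡⟨ fromℕ*uniformWeight (length orders) {{length-perms-nonZero (upTo b)}} ⟩
          1ℚ                                                    ∎)
      ; arePerms = All.map⁺ (tabulate binsOutput-↭)
      }
      where open ≡-Reasoning

    binsClique : List WeightedSet
    binsClique = map (λ j → u , bin h j) (upTo b)

    noCollision-binsClique : ∀ n → noCollision n binsClique [] ≡ elemSym n (replicate b u)
    noCollision-binsClique n = trans
      (noCollision-clique n binsClique []
        (AllPairs.map⁺ (AllPairs.map (bin-disjoint h) (Unique.upTo⁺ b)))
        (All.map⁺ (tabulate (λ {j} _ → (λ ()) , bin-nonEmpty h j))))
      (cong (elemSym n) (trans (sym (List.map-∘ (upTo b))) (trans (map-const u (upTo b)) (cong (λ l → replicate l u) (List.length-upTo b)))))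

    -- Only the first bin of the shuffled order matters, and it is uniformly distributed.
    noCollision-bins : ∀ n V → noCollision n (prefixes h (binsSupport m h)) V ≡ noCollision n binsClique V
    noCollision-bins zero    V = refl
    noCollision-bins (suc n) V = begin
      sumMap (λ (w , S) → w * reserving n L S V) (prefixes h (binsSupport m h))
        ≡⟨ trans (sumMap-map _ _ (binsSupport m h)) (sumMap-map _ _ orders) ⟩
      sumMap (λ σ → w * reserving n L (take h (binsOutput m h σ)) V) orders
        ≡⟨ sumMap-cong orders (λ σ∈ → cong (λ S → w * (𝟙 (disjoint S V) * noCollision n L (S ++ V))) (take-binsOutput σ∈)) ⟩
      sumMap (λ σ → w * g (headOr 0 σ)) orders
        ≡⟨ sumMap-*ˡ w (g ∘ headOr 0) orders ⟩
      w * sumMap (g ∘ headOr 0) orders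
        ≡⟨ perms-head-uniform g 0 (upTo b) {{subst ℕ.NonZero (sym (List.length-upTo b)) b-nonZero}} ⟩
      uniformWeight (length (upTo b)) * sumMap g (upTo b)
        ≡⟨ cong (λ l → uniformWeight l * sumMap g (upTo b)) (List.length-upTo b) ⟩
      u * sumMap g (upTo b)
        ≡⟨ sumMap-*ˡ u g (upTo b) ⟨
      sumMap (λ j → u * g j) (upTo b)
        ≡⟨ sumMap-cong (upTo b) (λ {j} _ → cong (λ r → u * (𝟙 (disjoint (bin h j) V) * r)) (noCollision-bins n (bin h j ++ V))) ⟩
      sumMap (λ j → u * reserving n binsClique (bin h j) V) (upTo b)
        ≡⟨ sumMap-map (λ (w , S) → w * reserving n binsClique S V) _ (upTo b) ⟨
      noCollision (suc n) binsClique V ∎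
      where
      open ≡-Reasoning
      L = prefixes h (binsSupport m h)
      w = uniformWeight (length orders)
      g : ℕ → ℚ
      g j = reserving n L (bin h j) V

    noCollision-≤-bins : ∀ n (A : Algorithm m) →
      noCollision n (prefixes h (Algorithm.support A)) [] ≤ noCollision n (prefixes h (binsSupport m h)) []
    noCollision-≤-bins n A
      with L , clique , admissible , total , merge-≤
             ← mergeToClique n (prefixes h (Algorithm.support A)) [] (prefixes-admissible h≤m A) = begin
      noCollision n (prefixes h (Algorithm.support A)) []  ≤⟨ merge-≤ ⟩
      noCollision n L []                                   ≡⟨ noCollision-clique n L [] clique (All.map (λ (_ , block) → (λ ()) , Block-nonEmpty block) admissible) ⟩
      elemSym n (map proj₁ L)                              ≤⟨ elemSym-≤-replicate n (map proj₁ L) |L|≤b 0≤weights (0≤uniformWeight b) total≡ ⟩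
      elemSym n (replicate b u)                            ≡⟨ noCollision-binsClique n ⟨
      noCollision n binsClique []                          ≡⟨ noCollision-bins n [] ⟨
      noCollision n (prefixes h (binsSupport m h)) []      ∎
      where
      open ℚ.≤-Reasoning
      |L|≤b : length (map proj₁ L) ℕ.≤ b
      |L|≤b = subst (ℕ._≤ b) (sym (List.length-map proj₁ L)) (clique-size L clique (All.map proj₂ admissible))
      0≤weights : All (0ℚ ≤_) (map proj₁ L)
      0≤weights = All.map⁺ (All.map proj₁ admissible)
      total≡ : sumℚ (map proj₁ L) ≡ fromℕ b * u
      total≡ = trans total (trans (sumMap-map proj₁ _ (Algorithm.support A))
                 (trans (totalWeight≡1 A) (sym (fromℕ*uniformWeight b))))

    algorithm-optimal : ∀ n (A : Algorithm m) → collProb algorithm (replicate n h) ≤ collProb A (replicate n h)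
    algorithm-optimal n A = begin
      collProb algorithm (replicate n h)                        ≡⟨ collProb-replicate algorithm h n ⟩
      1ℚ - noCollision n (prefixes h (binsSupport m h)) []      ≤⟨ ℚ.+-monoʳ-≤ 1ℚ (ℚ.neg-antimono-≤ (noCollision-≤-bins n A)) ⟩
      1ℚ - noCollision n (prefixes h (Algorithm.support A)) []  ≡⟨ collProb-replicate A h n ⟨
      collProb A (replicate n h)                                ∎
      where open ℚ.≤-Reasoning

open import Defs
open import Data.Nat using (ℕ; NonZero; _≤_)
open import Data.List using (replicate)
open import Data.Product using (Σ; _×_; _,_)
open import Relation.Binary.PropositionalEquality using (_≡_; refl)
import Data.Rational as Q
open BinsOptimality using (module Bins)

lemma5p2 : (m h n : ℕ) → .{{_ : NonZero h}} → h ≤ m → .{{_ : NonZero n}} →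
    Σ (Algorithm m) (λ B → (Algorithm.support B ≡ binsSupport m h)
      × ((A : Algorithm m) → collProb B (replicate n h) Q.≤ collProb A (replicate n h)))
lemma5p2 m h n h≤m = algorithm , refl , algorithm-optimal n
  where open Bins m h h≤m
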